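{- For $n\ge 5$, let $D_n$ be the graph with vertex set $\{v_1,\dots,v_n\}$ and edge set $\{v_iv_j : i,j\in\{1,\dots,n-4\},\ i\ne j\}\cup\{v_{n-3}v_i : 1\le i\le n-5\}\cup\{v_{n-2}v_i : 2\le i\le n-4\}\cup\{v_{n-2}v_{n-3},\ v_{n-1}v_{n-3},\ v_nv_{n-2}\}$. Then $D_n$ is $(n-2)$-critical.
   Context: A star coloring of a graph $G$ is a proper vertex-coloring such that no path on four vertices (as a subgraph) is colored with only two colors; $\chi_s(G)$ is the minimum number of colors in a star coloring of $G$. $G$ is $k$-critical if $\chi_s(G)=k$ and $\chi_s(G-e)<\chi_s(G)$ for every edge $e\in E(G)$, where $G-e$ denotes deletion of the edge $e$. -}

module Defs where

open import Data.Nat using (ℕ; suc; _∸_; _≤_; _<_)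
open import Data.Fin using (Fin; toℕ)
open import Data.Product using (_×_; ∃; ∃-syntax; Σ-syntax)
open import Data.Sum using (_⊎_)
open import Relation.Binary.PropositionalEquality using (_≡_; _≢_)
open import Relation.Nullary using (¬_)

Graph : ℕ → Set₁
Graph n = Fin n → Fin n → Set

_─_ : ∀ {n} → Graph n → Fin n × Fin n → Graph n
(G ─ (u Data.Product., v)) x y = G x y × ¬ ((x ≡ u × y ≡ v) ⊎ (x ≡ v × y ≡ u))

Proper : ∀ {n k} → Graph n → (Fin n → Fin k) → Set
Proper G c = ∀ u v → G u v → c u ≢ c v

P4 : ∀ {n} → Graph n → Fin n → Fin n → Fin n → Fin n → Set
P4 G a b c d =
  (a ≢ b × a ≢ c × a ≢ d × b ≢ c × b ≢ d × c ≢ d) ×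
  (G a b × G b c × G c d)

TwoColoured : ∀ {n k} → (Fin n → Fin k) → Fin n → Fin n → Fin n → Fin n → Set
TwoColoured {k = k} col a b c d =
  ∃[ x ] ∃[ y ] ( (col a ≡ x ⊎ col a ≡ y) × (col b ≡ x ⊎ col b ≡ y)
                × (col c ≡ x ⊎ col c ≡ y) × (col d ≡ x ⊎ col d ≡ y) )

StarColouring : ∀ {n k} → Graph n → (Fin n → Fin k) → Set
StarColouring G col =
  Proper G col × (∀ a b c d → P4 G a b c d → ¬ TwoColoured col a b c d)

StarColourable : ∀ {n} → Graph n → ℕ → Set
StarColourable {n} G k = Σ[ col ∈ (Fin n → Fin k) ] StarColouring G col

StarChromatic : ∀ {n} → Graph n → ℕ → Set
StarChromatic G k = StarColourable G k × (∀ m → m < k → ¬ StarColourable G m)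

Critical : ∀ {n} → Graph n → ℕ → Set
Critical G k =
  StarChromatic G k ×
  (∀ u v → G u v → ∃[ m ] (m < k × StarChromatic (G ─ (u Data.Product., v)) m))

-- Base edge relation of D_n on 1-based indices (i, j) meaning edge v_i v_j.
data DBase (n : ℕ) : ℕ → ℕ → Set where
  clique : ∀ {i j} → 1 ≤ i → i ≤ n ∸ 4 → 1 ≤ j → j ≤ n ∸ 4 → i ≢ j → DBase n i j
  e3     : ∀ {i} → 1 ≤ i → i ≤ n ∸ 5 → DBase n (n ∸ 3) i
  e2     : ∀ {i} → 2 ≤ i → i ≤ n ∸ 4 → DBase n (n ∸ 2) i
  e23    : DBase n (n ∸ 2) (n ∸ 3)
  e13    : DBase n (n ∸ 1) (n ∸ 3)
  e02    : DBase n n (n ∸ 2)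

-- D_n on vertex set Fin n, where vertex x ∈ Fin n is v_{toℕ x + 1}.
D : (n : ℕ) → Graph n
D n x y = DBase n (suc (toℕ x)) (suc (toℕ y)) ⊎ DBase n (suc (toℕ y)) (suc (toℕ x))

{-# OPTIONS --safe #-}
-- Write n = k + 5.  The vertices v_1, …, v_{k+1} form a clique, so a star colouring with k + 2
-- colours leaves a single spare colour outside the clique (pigeonhole).  In the clique v_{n-3}
-- misses only v_{k+1} and v_{n-2} misses only v_1, so each of them repeats the colour of that
-- vertex or takes the spare colour; in every combination, with help from the pendant vertices
-- v_{n-1} and v_n, some P₄ is two-coloured.  Reversing the clique while swapping v_{n-3} ↔ v_{n-2}
-- and v_{n-1} ↔ v_n is an automorphism, which halves the case analysis.  Explicit colourings
-- use k + 3 colours for D_n and k + 2 colours for each D_n − e; since star colourability of a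
-- finite graph is decidable, χ_s(D_n − e) is then the least number of colours that works.
module Submission where

open import Defs
open import Data.Nat as ℕ using (ℕ; zero; suc; _+_; _≤_; _<_; _∸_; z≤n; s≤s)
import Data.Nat.Properties as ℕₚ
open import Data.Fin as Fin
  using (Fin; toℕ; fromℕ<; fromℕ; inject≤; cast; join; splitAt; opposite; finToFun; funToFin)
import Data.Fin.Properties as Finₚ
open import Data.Fin.Patterns using (0F; 1F; 2F; 3F)
open import Data.Product as Product using (Σ; ∃-syntax; _×_; _,_; proj₁; proj₂)
open import Data.Sum as Sum using (_⊎_; inj₁; inj₂)
open import Data.Empty using (⊥; ⊥-elim)
open import Function using (_∘_; id)
open import Function.Definitions using (Injective)
open import Relation.Nullary using (¬_; Dec; yes; no)
open import Relation.Nullary.Decidable using (map′; _×-dec_; _⊎-dec_; _→-dec_; ¬?)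
open import Relation.Binary.PropositionalEquality

GraphOn : Set → Set₁
GraphOn V = V → V → Set

Undirected : ∀ {V} → GraphOn V → GraphOn V
Undirected R u v = R u v ⊎ R v u

undirected-sym : ∀ {V} {R : GraphOn V} {u v} → Undirected R u v → Undirected R v u
undirected-sym = Sum.swap

Pair : ∀ {V : Set} → V → V → V → V → Set
Pair p q u v = (u ≡ p × v ≡ q) ⊎ (u ≡ q × v ≡ p)

pair-sym : ∀ {V : Set} {p q u v : V} → Pair p q u v → Pair p q v u
pair-sym (inj₁ (u≡p , v≡q)) = inj₂ (v≡q , u≡p)
pair-sym (inj₂ (u≡q , v≡p)) = inj₁ (v≡p , u≡q)

pair-swap : ∀ {V : Set} {p q u v : V} → Pair p q u v → Pair q p u v
pair-swap = Sum.swap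

pair-comap : ∀ {V W : Set} {φ : V → W} → Injective _≡_ _≡_ φ →
             ∀ {p q u v} → Pair (φ p) (φ q) (φ u) (φ v) → Pair p q u v
pair-comap φ-inj = Sum.map (Product.map φ-inj φ-inj) (Product.map φ-inj φ-inj)

_∖_ : ∀ {V} → GraphOn V → V × V → GraphOn V
(G ∖ (p , q)) u v = G u v × ¬ Pair p q u v

∖-sym : ∀ {V} {G : GraphOn V} {p q u v} → (∀ {x y} → G x y → G y x) →
        (G ∖ (p , q)) u v → (G ∖ (p , q)) v u
∖-sym G-sym (uv , ¬pair) = G-sym uv , ¬pair ∘ pair-sym

∖-swap : ∀ {V} {G : GraphOn V} {p q u v} → (G ∖ (p , q)) u v → (G ∖ (q , p)) u v
∖-swap (uv , ¬pair) = uv , ¬pair ∘ pair-swap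

∖-hom : ∀ {V W : Set} {H : GraphOn V} {G : GraphOn W} (φ : V → W) → Injective _≡_ _≡_ φ →
        (∀ {u v} → H u v → G (φ u) (φ v)) →
        ∀ {p q u v} → (H ∖ (p , q)) u v → (G ∖ (φ p , φ q)) (φ u) (φ v)
∖-hom φ φ-inj hom (uv , ¬pair) = hom uv , ¬pair ∘ pair-comap φ-inj

IsProper : ∀ {V C : Set} → GraphOn V → (V → C) → Set
IsProper G f = ∀ u v → G u v → f u ≢ f v

IsPath₄ : ∀ {V : Set} → GraphOn V → V → V → V → V → Set
IsPath₄ G a b c d =
  (a ≢ b × a ≢ c × a ≢ d × b ≢ c × b ≢ d × c ≢ d) × (G a b × G b c × G c d)

Alternating : ∀ {V C : Set} → (V → C) → V → V → V → V → Set
Alternating f a b c d = f a ≡ f c × f b ≡ f d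

IsStar : ∀ {V C : Set} → GraphOn V → (V → C) → Set
IsStar G f = IsProper G f × (∀ a b c d → IsPath₄ G a b c d → ¬ Alternating f a b c d)

alternate-if-two-coloured : ∀ {C : Set} {x y p q r : C} →
  (p ≡ x ⊎ p ≡ y) → (q ≡ x ⊎ q ≡ y) → (r ≡ x ⊎ r ≡ y) → p ≢ q → q ≢ r → p ≡ r
alternate-if-two-coloured (inj₁ refl) (inj₁ refl) _           p≢q _   = ⊥-elim (p≢q refl)
alternate-if-two-coloured (inj₁ refl) (inj₂ refl) (inj₁ refl) _   _   = refl
alternate-if-two-coloured (inj₁ refl) (inj₂ refl) (inj₂ refl) _   q≢r = ⊥-elim (q≢r refl)
alternate-if-two-coloured (inj₂ refl) (inj₁ refl) (inj₁ refl) _   q≢r = ⊥-elim (q≢r refl)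
alternate-if-two-coloured (inj₂ refl) (inj₁ refl) (inj₂ refl) _   _   = refl
alternate-if-two-coloured (inj₂ refl) (inj₂ refl) _           p≢q _   = ⊥-elim (p≢q refl)

starColouring⇒isStar : ∀ {n k} {G : Graph n} {col : Fin n → Fin k} →
                       StarColouring G col → IsStar G col
starColouring⇒isStar {col = col} (proper , star) =
  proper , λ a b c d path (ac , bd) →
    star a b c d path (col a , col b , inj₁ refl , inj₂ refl , inj₁ (sym ac) , inj₂ (sym bd))

isStar⇒starColouring : ∀ {n k} {G : Graph n} {col : Fin n → Fin k} →
                       IsStar G col → StarColouring G col
isStar⇒starColouring (proper , star) =
  proper , λ { a b c d path@(_ , ab , bc , cd) (_ , _ , a∈ , b∈ , c∈ , d∈) →
    star a b c d path
      ( alternate-if-two-coloured a∈ b∈ c∈ (proper a b ab) (proper b c bc)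
      , alternate-if-two-coloured b∈ c∈ d∈ (proper b c bc) (proper c d cd)) }

isStar-comap : ∀ {V W C : Set} {H : GraphOn V} {G : GraphOn W} {f : W → C} (φ : V → W) →
               Injective _≡_ _≡_ φ → (∀ {u v} → H u v → G (φ u) (φ v)) →
               IsStar G f → IsStar H (f ∘ φ)
isStar-comap φ φ-inj hom (proper , star) =
  (λ u v uv → proper (φ u) (φ v) (hom uv)) ,
  λ { a b c d ((a≢b , a≢c , a≢d , b≢c , b≢d , c≢d) , ab , bc , cd) →
      star (φ a) (φ b) (φ c) (φ d)
        ( (a≢b ∘ φ-inj , a≢c ∘ φ-inj , a≢d ∘ φ-inj , b≢c ∘ φ-inj , b≢d ∘ φ-inj , c≢d ∘ φ-inj)
        , hom ab , hom bc , hom cd) }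

isStar-map : ∀ {V C C′ : Set} {H : GraphOn V} {f : V → C} (ψ : C → C′) →
             Injective _≡_ _≡_ ψ → IsStar H f → IsStar H (ψ ∘ f)
isStar-map ψ ψ-inj (proper , star) =
  (λ u v uv → proper u v uv ∘ ψ-inj) ,
  λ a b c d path (ac , bd) → star a b c d path (ψ-inj ac , ψ-inj bd)

isStar-unmap : ∀ {V C C′ : Set} {H : GraphOn V} {f : V → C} (θ : C → C′) →
               IsStar H (θ ∘ f) → IsStar H f
isStar-unmap θ (proper , star) =
  (λ u v uv → proper u v uv ∘ cong θ) ,
  λ a b c d path (ac , bd) → star a b c d path (cong θ ac , cong θ bd)

isStar-resp-≗ : ∀ {V C : Set} {H : GraphOn V} {f g : V → C} →
                (∀ v → f v ≡ g v) → IsStar H f → IsStar H g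
isStar-resp-≗ {f = f} {g} f≗g (proper , star) =
  (λ u v uv → proper u v uv ∘ lift) ,
  λ a b c d path (ac , bd) → star a b c d path (lift ac , lift bd)
  where
  lift : ∀ {u v} → g u ≡ g v → f u ≡ f v
  lift {u} {v} e = trans (f≗g u) (trans e (sym (f≗g v)))

starColourable-mono : ∀ {n a b} {G : Graph n} → a ≤ b → StarColourable G a → StarColourable G b
starColourable-mono a≤b (_ , star) =
  _ , isStar⇒starColouring
        (isStar-map (λ c → inject≤ c a≤b) (Finₚ.inject≤-injective a≤b a≤b _ _)
          (starColouring⇒isStar star))

isStar? : ∀ {n k} {G : Graph n} → (∀ x y → Dec (G x y)) → (col : Fin n → Fin k) → Dec (IsStar G col)
isStar? G? col =
  Finₚ.all? (λ u → Finₚ.all? (λ v → G? u v →-dec ¬? (col u Finₚ.≟ col v))) ×-dec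
  Finₚ.all? (λ a → Finₚ.all? (λ b → Finₚ.all? (λ c → Finₚ.all? (λ d →
    (  (¬? (a Finₚ.≟ b) ×-dec ¬? (a Finₚ.≟ c) ×-dec ¬? (a Finₚ.≟ d)
        ×-dec ¬? (b Finₚ.≟ c) ×-dec ¬? (b Finₚ.≟ d) ×-dec ¬? (c Finₚ.≟ d))
    ×-dec (G? a b ×-dec G? b c ×-dec G? c d))
    →-dec ¬? ((col a Finₚ.≟ col c) ×-dec (col b Finₚ.≟ col d))))))

starColourable? : ∀ {n} {G : Graph n} → (∀ x y → Dec (G x y)) → ∀ k → Dec (StarColourable G k)
starColourable? G? k =
  map′ (λ (i , star) → finToFun i , isStar⇒starColouring star)
       (λ (col , star) → funToFin col ,
          isStar-resp-≗ (sym ∘ Finₚ.finToFun-funToFin col) (starColouring⇒isStar star))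
       (Finₚ.any? (isStar? G? ∘ finToFun))

starChromatic-≤ : ∀ {n} {G : Graph n} → (∀ m → Dec (StarColourable G m)) →
                  ∀ k → StarColourable G k → ∃[ m ] (m ≤ k × StarChromatic G m)
starChromatic-≤ colourable? zero colourable = 0 , z≤n , colourable , λ _ ()
starChromatic-≤ colourable? (suc k) colourable with colourable? k
... | yes colourableₖ =
  let m , m≤k , χ = starChromatic-≤ colourable? k colourableₖ in m , ℕₚ.m≤n⇒m≤1+n m≤k , χ
... | no ¬colourableₖ =
  suc k , ℕₚ.≤-refl , colourable ,
  λ m m<1+k colourableₘ → ¬colourableₖ (starColourable-mono (ℕₚ.≤-pred m<1+k) colourableₘ)

module _ {V C : Set} {H : GraphOn V} {f : V → C} (proper : IsProper H f) where

  isStar-if-one-repeated-colour :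
    (z : C) → (∀ u w → u ≢ w → f u ≡ f w → f u ≡ z) → IsStar H f
  isStar-if-one-repeated-colour z repeated =
    proper , λ { a b c d ((_ , a≢c , _ , _ , b≢d , _) , ab , _ , _) (ac , bd) →
      proper a b ab (trans (repeated a c a≢c ac) (sym (repeated b d b≢d bd))) }

  -- An alternating path would have a z-coloured vertex whose two path neighbours are p and q.
  isStar-if-one-repeated-colour-and-pair :
    (z : C) (p q : V) → (∀ {u v} → H u v → H v u) →
    (∀ u w → u ≢ w → f u ≡ f w → f u ≡ z ⊎ Pair p q u w) →
    (∀ v → f v ≡ z → H v p → H v q → ⊥) → IsStar H f
  isStar-if-one-repeated-colour-and-pair z p q H-sym repeated no-z-common-neighbour =
    proper , λ { a b c d ((a≢b , a≢c , a≢d , _ , b≢d , _) , ab , bc , cd) (ac , bd) →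
      refute a≢b a≢d ab bc cd ac (repeated a c a≢c ac) (repeated b d b≢d bd) }
    where
    neighbours-of-pair : ∀ {u v w} → Pair p q u w → H v u → H v w → H v p × H v q
    neighbours-of-pair (inj₁ (refl , refl)) vu vw = vu , vw
    neighbours-of-pair (inj₂ (refl , refl)) vu vw = vw , vu

    pairs-meet : ∀ {a b c d} → Pair p q a c → Pair p q b d → a ≡ b ⊎ a ≡ d
    pairs-meet (inj₁ (refl , refl)) (inj₁ (refl , refl)) = inj₁ refl
    pairs-meet (inj₁ (refl , refl)) (inj₂ (refl , refl)) = inj₂ refl
    pairs-meet (inj₂ (refl , refl)) (inj₁ (refl , refl)) = inj₂ refl
    pairs-meet (inj₂ (refl , refl)) (inj₂ (refl , refl)) = inj₁ refl

    refute : ∀ {a b c d} → a ≢ b → a ≢ d → H a b → H b c → H c d → f a ≡ f c →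
             f a ≡ z ⊎ Pair p q a c → f b ≡ z ⊎ Pair p q b d → ⊥
    refute _ _ ab _ _ _ (inj₁ az) (inj₁ bz) = proper _ _ ab (trans az (sym bz))
    refute _ _ _ bc cd ac (inj₁ az) (inj₂ bd) =
      let cp , cq = neighbours-of-pair bd (H-sym bc) cd
      in no-z-common-neighbour _ (trans (sym ac) az) cp cq
    refute _ _ ab bc _ _ (inj₂ ac) (inj₁ bz) =
      let bp , bq = neighbours-of-pair ac (H-sym ab) bc
      in no-z-common-neighbour _ bz bp bq
    refute a≢b a≢d _ _ _ _ (inj₂ ac) (inj₂ bd) with pairs-meet ac bd
    ... | inj₁ a≡b = a≢b a≡b
    ... | inj₂ a≡d = a≢d a≡d

starColouring-fromℕ : ∀ {V : Set} {H : GraphOn V} {c} (h : V → ℕ) →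
                      (∀ v → h v < c) → IsStar H h → Σ (V → Fin c) (IsStar H)
starColouring-fromℕ h h<c star = (λ v → fromℕ< (h<c v)) ,
  isStar-unmap toℕ (isStar-resp-≗ (λ v → sym (Finₚ.toℕ-fromℕ< (h<c v))) star)

module _ {V C : Set} {R : GraphOn V} {h : V → C} where

  isProper-undirected : (∀ {u v} → R u v → h u ≢ h v) → IsProper (Undirected R) h
  isProper-undirected proper _ _ (inj₁ uv) = proper uv
  isProper-undirected proper _ _ (inj₂ vu) = proper vu ∘ sym

  isProper-undirected-∖ : ∀ {p q} → (∀ {u v} → R u v → ¬ Pair p q u v → h u ≢ h v) →
                          IsProper (Undirected R ∖ (p , q)) h
  isProper-undirected-∖ proper _ _ (inj₁ uv , ¬pair) = proper uv ¬pair
  isProper-undirected-∖ proper _ _ (inj₂ vu , ¬pair) = proper vu (¬pair ∘ pair-sym) ∘ sym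

DBaseCondition : ℕ → ℕ → ℕ → Set
DBaseCondition n i j =
  (1 ≤ i × i ≤ n ∸ 4 × 1 ≤ j × j ≤ n ∸ 4 × i ≢ j) ⊎ (i ≡ n ∸ 3 × 1 ≤ j × j ≤ n ∸ 5) ⊎
  (i ≡ n ∸ 2 × 2 ≤ j × j ≤ n ∸ 4) ⊎ (i ≡ n ∸ 2 × j ≡ n ∸ 3) ⊎
  (i ≡ n ∸ 1 × j ≡ n ∸ 3) ⊎ (i ≡ n × j ≡ n ∸ 2)

dbase⇒condition : ∀ {n i j} → DBase n i j → DBaseCondition n i j
dbase⇒condition (clique 1≤i i≤ 1≤j j≤ i≢j) = inj₁ (1≤i , i≤ , 1≤j , j≤ , i≢j)
dbase⇒condition (e3 1≤j j≤)                = inj₂ (inj₁ (refl , 1≤j , j≤))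
dbase⇒condition (e2 2≤j j≤)                = inj₂ (inj₂ (inj₁ (refl , 2≤j , j≤)))
dbase⇒condition e23 = inj₂ (inj₂ (inj₂ (inj₁ (refl , refl))))
dbase⇒condition e13 = inj₂ (inj₂ (inj₂ (inj₂ (inj₁ (refl , refl)))))
dbase⇒condition e02 = inj₂ (inj₂ (inj₂ (inj₂ (inj₂ (refl , refl)))))

condition⇒dbase : ∀ {n i j} → DBaseCondition n i j → DBase n i j
condition⇒dbase (inj₁ (1≤i , i≤ , 1≤j , j≤ , i≢j))                = clique 1≤i i≤ 1≤j j≤ i≢j
condition⇒dbase (inj₂ (inj₁ (refl , 1≤j , j≤)))                    = e3 1≤j j≤
condition⇒dbase (inj₂ (inj₂ (inj₁ (refl , 2≤j , j≤))))             = e2 2≤j j≤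
condition⇒dbase (inj₂ (inj₂ (inj₂ (inj₁ (refl , refl)))))          = e23
condition⇒dbase (inj₂ (inj₂ (inj₂ (inj₂ (inj₁ (refl , refl))))))   = e13
condition⇒dbase (inj₂ (inj₂ (inj₂ (inj₂ (inj₂ (refl , refl))))))   = e02

dbase? : ∀ n i j → Dec (DBase n i j)
dbase? n i j = map′ condition⇒dbase dbase⇒condition
  (   (1 ℕ.≤? i ×-dec i ℕ.≤? n ∸ 4 ×-dec 1 ℕ.≤? j ×-dec j ℕ.≤? n ∸ 4 ×-dec ¬? (i ℕ.≟ j))
  ⊎-dec (i ℕ.≟ n ∸ 3 ×-dec 1 ℕ.≤? j ×-dec j ℕ.≤? n ∸ 5)
  ⊎-dec (i ℕ.≟ n ∸ 2 ×-dec 2 ℕ.≤? j ×-dec j ℕ.≤? n ∸ 4)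
  ⊎-dec (i ℕ.≟ n ∸ 2 ×-dec j ℕ.≟ n ∸ 3)
  ⊎-dec (i ℕ.≟ n ∸ 1 ×-dec j ℕ.≟ n ∸ 3)
  ⊎-dec (i ℕ.≟ n ×-dec j ℕ.≟ n ∸ 2))

D-deletion? : ∀ n (e : Fin n × Fin n) x y → Dec ((D n ─ e) x y)
D-deletion? n (p , q) x y =
  (dbase? n _ _ ⊎-dec dbase? n _ _) ×-dec
  ¬? ((x Finₚ.≟ p ×-dec y Finₚ.≟ q) ⊎-dec (x Finₚ.≟ q ×-dec y Finₚ.≟ p))

module Dₙ (k : ℕ) where

  n : ℕ
  n = 5 + k

  -- Vertex v_{i+1} of the paper is κ i, and v_{n-3}, v_{n-2}, v_{n-1}, v_n are u₃, u₂, u₁, u₀.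
  V : Set
  V = Fin (suc k) ⊎ Fin 4

  pattern κ i = inj₁ i
  pattern u₃ = inj₂ 0F
  pattern u₂ = inj₂ 1F
  pattern u₁ = inj₂ 2F
  pattern u₀ = inj₂ 3F

  κ-injective : ∀ {i j} → _≡_ {A = V} (κ i) (κ j) → i ≡ j
  κ-injective refl = refl

  top : Fin (suc k)
  top = fromℕ k

  data Arc : V → V → Set where
    κ-κ   : ∀ {i j} → i ≢ j → Arc (κ i) (κ j)
    u₃-κ  : ∀ {i} → toℕ i < k → Arc u₃ (κ i)
    u₂-κ  : ∀ {i} → 1 ≤ toℕ i → Arc u₂ (κ i)
    u₂-u₃ : Arc u₂ u₃
    u₁-u₃ : Arc u₁ u₃
    u₀-u₂ : Arc u₀ u₂

  E : GraphOn V
  E = Undirected Arc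

  size : suc k + 4 ≡ n
  size = ℕₚ.+-comm (suc k) 4

  emb : V → Fin n
  emb = cast size ∘ join (suc k) 4

  view : Fin n → V
  view = splitAt (suc k) ∘ cast (sym size)

  view-emb : ∀ v → view (emb v) ≡ v
  view-emb v =
    trans (cong (splitAt (suc k)) (Finₚ.cast-involutive (sym size) size (join (suc k) 4 v)))
          (Finₚ.splitAt-join (suc k) 4 v)

  emb-view : ∀ x → emb (view x) ≡ x
  emb-view x =
    trans (cong (cast size) (Finₚ.join-splitAt (suc k) 4 (cast (sym size) x)))
          (Finₚ.cast-involutive size (sym size) x)

  view-injective : Injective _≡_ _≡_ view
  view-injective {x} {y} vx≡vy = trans (sym (emb-view x)) (trans (cong emb vx≡vy) (emb-view y))

  emb-injective : Injective _≡_ _≡_ emb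
  emb-injective {u} {v} eu≡ev = trans (sym (view-emb u)) (trans (cong view eu≡ev) (view-emb v))

  -- Adding suc k on the right makes index u₃, …, index u₀ compute to suc k, …, 4 + k.
  index : V → ℕ
  index (κ i)    = toℕ i
  index (inj₂ j) = toℕ j + suc k

  toℕ-emb : ∀ v → toℕ (emb v) ≡ index v
  toℕ-emb v = trans (Finₚ.toℕ-cast size (join (suc k) 4 v)) (toℕ-join v)
    where
    toℕ-join : ∀ v → toℕ (join (suc k) 4 v) ≡ index v
    toℕ-join (κ i)    = Finₚ.toℕ-↑ˡ i 4
    toℕ-join (inj₂ j) = trans (Finₚ.toℕ-↑ʳ (suc k) j) (ℕₚ.+-comm (suc k) (toℕ j))

  view-at : ∀ x v → toℕ x ≡ index v → view x ≡ v
  view-at x v x≡v =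
    trans (cong view (Finₚ.toℕ-injective (trans x≡v (sym (toℕ-emb v))))) (view-emb v)

  arc⇒dbase : ∀ {u v} → Arc u v → DBase n (suc (index u)) (suc (index v))
  arc⇒dbase (κ-κ {i} {j} i≢j) =
    clique (s≤s z≤n) (Finₚ.toℕ<n i) (s≤s z≤n) (Finₚ.toℕ<n j)
           (i≢j ∘ Finₚ.toℕ-injective ∘ ℕₚ.suc-injective)
  arc⇒dbase (u₃-κ i<k)     = e3 (s≤s z≤n) i<k
  arc⇒dbase (u₂-κ {i} 1≤i) = e2 (s≤s 1≤i) (Finₚ.toℕ<n i)
  arc⇒dbase u₂-u₃          = e23
  arc⇒dbase u₁-u₃          = e13
  arc⇒dbase u₀-u₂          = e02

  edge-emb : ∀ {u v} → E u v → D n (emb u) (emb v)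
  edge-emb {u} {v} uv rewrite toℕ-emb u | toℕ-emb v = Sum.map arc⇒dbase arc⇒dbase uv

  arc-at : ∀ {u v} x y → toℕ x ≡ index u → toℕ y ≡ index v → Arc u v → Arc (view x) (view y)
  arc-at {u} {v} x y x≡u y≡v = subst₂ Arc (sym (view-at x u x≡u)) (sym (view-at y v y≡v))

  dbase⇒arc : ∀ {i j} x y → DBase n i j → suc (toℕ x) ≡ i → suc (toℕ y) ≡ j →
              Arc (view x) (view y)
  dbase⇒arc x y (clique _ x<1+k _ y<1+k x≢y) refl refl =
    arc-at x y (sym (Finₚ.toℕ-fromℕ< x<1+k)) (sym (Finₚ.toℕ-fromℕ< y<1+k))
      (κ-κ (x≢y ∘ cong suc ∘ Finₚ.fromℕ<-injective _ _ x<1+k y<1+k))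
  dbase⇒arc x y (e3 _ y<k) x≡ refl =
    arc-at x y (ℕₚ.suc-injective x≡) (sym (Finₚ.toℕ-fromℕ< y<1+k))
      (u₃-κ (subst (_< k) (sym (Finₚ.toℕ-fromℕ< y<1+k)) y<k))
    where y<1+k = ℕₚ.m<n⇒m<1+n y<k
  dbase⇒arc x y (e2 2≤1+y y<1+k) x≡ refl =
    arc-at x y (ℕₚ.suc-injective x≡) (sym (Finₚ.toℕ-fromℕ< y<1+k))
      (u₂-κ (subst (1 ≤_) (sym (Finₚ.toℕ-fromℕ< y<1+k)) (ℕₚ.≤-pred 2≤1+y)))
  dbase⇒arc x y e23 x≡ y≡ = arc-at x y (ℕₚ.suc-injective x≡) (ℕₚ.suc-injective y≡) u₂-u₃
  dbase⇒arc x y e13 x≡ y≡ = arc-at x y (ℕₚ.suc-injective x≡) (ℕₚ.suc-injective y≡) u₁-u₃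
  dbase⇒arc x y e02 x≡ y≡ = arc-at x y (ℕₚ.suc-injective x≡) (ℕₚ.suc-injective y≡) u₀-u₂

  edge-view : ∀ {x y} → D n x y → E (view x) (view y)
  edge-view = Sum.map (λ d → dbase⇒arc _ _ d refl refl) (λ d → dbase⇒arc _ _ d refl refl)

  bottom : Fin (suc k)
  bottom = 0F

  top-if-≮ : ∀ i → ¬ toℕ i < k → i ≡ top
  top-if-≮ i i≮k = Finₚ.toℕ-injective
    (trans (ℕₚ.≤-antisym (ℕₚ.≤-pred (Finₚ.toℕ<n i)) (ℕₚ.≮⇒≥ i≮k)) (sym (Finₚ.toℕ-fromℕ k)))

  ≢top-if-< : ∀ {i} → toℕ i < k → i ≢ top
  ≢top-if-< i<k i≡top = ℕₚ.<⇒≢ i<k (trans (cong toℕ i≡top) (Finₚ.toℕ-fromℕ k))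

  mirror : V → V
  mirror (κ i) = κ (opposite i)
  mirror u₃    = u₂
  mirror u₂    = u₃
  mirror u₁    = u₀
  mirror u₀    = u₁

  mirror-involutive : ∀ v → mirror (mirror v) ≡ v
  mirror-involutive (κ i) = cong κ (Finₚ.opposite-involutive i)
  mirror-involutive u₃    = refl
  mirror-involutive u₂    = refl
  mirror-involutive u₁    = refl
  mirror-involutive u₀    = refl

  mirror-injective : Injective _≡_ _≡_ mirror
  mirror-injective {u} {v} mu≡mv =
    trans (sym (mirror-involutive u)) (trans (cong mirror mu≡mv) (mirror-involutive v))

  arc-mirror : ∀ {u v} → Arc u v → E (mirror u) (mirror v)
  arc-mirror (κ-κ {i} {j} i≢j) =
    inj₁ (κ-κ λ oi≡oj → i≢j (trans (sym (Finₚ.opposite-involutive i))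
                              (trans (cong opposite oi≡oj) (Finₚ.opposite-involutive j))))
  arc-mirror (u₃-κ {i} i<k) =
    inj₁ (u₂-κ (subst (1 ≤_) (sym (Finₚ.opposite-prop i)) (ℕₚ.m<n⇒0<n∸m i<k)))
  arc-mirror (u₂-κ {i} 1≤i) =
    inj₁ (u₃-κ (subst (_< k) (sym (Finₚ.opposite-prop i))
                  (ℕₚ.∸-monoʳ-< 1≤i (ℕₚ.≤-pred (Finₚ.toℕ<n i)))))
  arc-mirror u₂-u₃ = inj₂ u₂-u₃
  arc-mirror u₁-u₃ = inj₁ u₀-u₂
  arc-mirror u₀-u₂ = inj₁ u₁-u₃

  edge-mirror : ∀ {u v} → E u v → E (mirror u) (mirror v)
  edge-mirror (inj₁ uv) = arc-mirror uv
  edge-mirror (inj₂ vu) = undirected-sym {R = Arc} (arc-mirror vu)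

  Spare : (V → Fin (2 + k)) → V → Set
  Spare f v = ∀ i → f v ≢ f (κ i)

  module StarColouring₂₊ₖ (f : V → Fin (2 + k)) (f-star : IsStar E f) where

    proper : IsProper E f
    proper = proj₁ f-star

    no-alternating-path : ∀ {a b c d} → IsPath₄ E a b c d → ¬ Alternating f a b c d
    no-alternating-path = proj₂ f-star _ _ _ _

    spare-or-matched : ∀ v → Spare f v ⊎ ∃[ i ] f v ≡ f (κ i)
    spare-or-matched v with Finₚ.any? (λ i → f v Finₚ.≟ f (κ i))
    ... | yes matched  = inj₂ matched
    ... | no unmatched = inj₁ λ i fv≡fi → unmatched (i , fv≡fi)

    -- The clique already uses 1 + k of the 2 + k colours.
    spares-agree : ∀ {p q} → Spare f p → Spare f q → f p ≡ f q
    spares-agree {p} {q} p-spare q-spare with f p Finₚ.≟ f q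
    ... | yes fp≡fq = fp≡fq
    ... | no fp≢fq  =
      let i , j , i<j , ci≡cj = Finₚ.pigeonhole (ℕₚ.n<1+n (2 + k)) colours
      in ⊥-elim (colours-distinct (Finₚ.<⇒≢ i<j) ci≡cj)
      where
      colours : Fin (3 + k) → Fin (2 + k)
      colours 0F                    = f p
      colours 1F                    = f q
      colours (Fin.suc (Fin.suc i)) = f (κ i)

      colours-distinct : ∀ {i j} → i ≢ j → colours i ≢ colours j
      colours-distinct {0F}                  {0F}                  i≢j = ⊥-elim (i≢j refl)
      colours-distinct {0F}                  {1F}                  _   = fp≢fq
      colours-distinct {0F}                  {Fin.suc (Fin.suc j)} _   = p-spare j
      colours-distinct {1F}                  {0F}                  _   = fp≢fq ∘ sym
      colours-distinct {1F}                  {1F}                  i≢j = ⊥-elim (i≢j refl)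
      colours-distinct {1F}                  {Fin.suc (Fin.suc j)} _   = q-spare j
      colours-distinct {Fin.suc (Fin.suc i)} {0F}                  _   = p-spare i ∘ sym
      colours-distinct {Fin.suc (Fin.suc i)} {1F}                  _   = q-spare i ∘ sym
      colours-distinct {Fin.suc (Fin.suc i)} {Fin.suc (Fin.suc j)} i≢j =
        proper (κ i) (κ j) (inj₁ (κ-κ (i≢j ∘ cong (Fin.suc ∘ Fin.suc))))

    u₃-matches-top : ∀ i → f u₃ ≡ f (κ i) → f u₃ ≡ f (κ top)
    u₃-matches-top i u₃≡i with toℕ i ℕ.<? k
    ... | yes i<k = ⊥-elim (proper u₃ (κ i) (inj₁ (u₃-κ i<k)) u₃≡i)
    ... | no i≮k  = subst (λ j → f u₃ ≡ f (κ j)) (top-if-≮ i i≮k) u₃≡i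

    u₂-matches-bottom : ∀ i → f u₂ ≡ f (κ i) → f u₂ ≡ f (κ bottom)
    u₂-matches-bottom 0F          u₂≡i = u₂≡i
    u₂-matches-bottom (Fin.suc i) u₂≡i = ⊥-elim (proper u₂ _ (inj₁ (u₂-κ (s≤s z≤n))) u₂≡i)

    top-and-bottom : f u₃ ≡ f (κ top) → f u₂ ≡ f (κ bottom) → ⊥
    top-and-bottom u₃≡top u₂≡bottom with 0 ℕ.<? k
    ... | yes 0<k =
      no-alternating-path
        ( ((λ ()) , (λ ()) , (λ ()) , (λ ()) , (λ ()) , ≢top-if-< 0<k ∘ κ-injective)
        , inj₁ u₂-u₃ , inj₁ (u₃-κ 0<k) , inj₁ (κ-κ (≢top-if-< 0<k)))
        (u₂≡bottom , u₃≡top)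
    ... | no 0≮k =
      proper u₂ u₃ (inj₁ u₂-u₃)
        (trans u₂≡bottom (trans (cong (f ∘ κ) (top-if-≮ bottom 0≮k)) (sym u₃≡top)))

    u₁-spare : f u₃ ≡ f (κ top) → Spare f u₁
    u₁-spare u₃≡top j u₁≡j with toℕ j ℕ.<? k
    ... | yes j<k =
      no-alternating-path
        ( ((λ ()) , (λ ()) , (λ ()) , (λ ()) , (λ ()) , ≢top-if-< j<k ∘ κ-injective)
        , inj₁ u₁-u₃ , inj₁ (u₃-κ j<k) , inj₁ (κ-κ (≢top-if-< j<k)))
        (u₁≡j , u₃≡top)
    ... | no j≮k =
      proper u₁ u₃ (inj₁ u₁-u₃)
        (trans u₁≡j (trans (cong (f ∘ κ) (top-if-≮ j j≮k)) (sym u₃≡top)))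

    -- For k = 0 the edge u₂ — κ top is missing, and the pendant vertex u₀ takes its place.
    top-and-spare : f u₃ ≡ f (κ top) → Spare f u₂ → ⊥
    top-and-spare u₃≡top u₂-spare with spares-agree u₂-spare (u₁-spare u₃≡top) | 0 ℕ.<? k
    ... | u₂≡u₁ | yes 0<k =
      no-alternating-path
        ( ((λ ()) , (λ ()) , (λ ()) , (λ ()) , (λ ()) , (λ ()))
        , inj₂ (u₂-κ (subst (1 ≤_) (sym (Finₚ.toℕ-fromℕ k)) 0<k)) , inj₁ u₂-u₃ , inj₂ u₁-u₃)
        (sym u₃≡top , u₂≡u₁)
    ... | u₂≡u₁ | no 0≮k with spare-or-matched u₀
    ...   | inj₁ u₀-spare = proper u₀ u₂ (inj₁ u₀-u₂) (spares-agree u₀-spare u₂-spare)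
    ...   | inj₂ (j , u₀≡j) =
      no-alternating-path
        ( ((λ ()) , (λ ()) , (λ ()) , (λ ()) , (λ ()) , (λ ()))
        , inj₁ u₀-u₂ , inj₁ u₂-u₃ , inj₂ u₁-u₃)
        ( trans u₀≡j (trans (cong (f ∘ κ) (top-if-≮ j (0≮k ∘ ℕₚ.≤-<-trans z≤n))) (sym u₃≡top))
        , u₂≡u₁)

  no-star-colouring₂₊ₖ : (f : V → Fin (2 + k)) → ¬ IsStar E f
  no-star-colouring₂₊ₖ f f-star = by-cases (spare-or-matched u₃) (spare-or-matched u₂)
    where
    open StarColouring₂₊ₖ f f-star

    by-cases : Spare f u₃ ⊎ ∃[ i ] f u₃ ≡ f (κ i) → Spare f u₂ ⊎ ∃[ j ] f u₂ ≡ f (κ j) → ⊥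
    by-cases (inj₂ (i , u₃≡i)) (inj₂ (j , u₂≡j)) =
      top-and-bottom (u₃-matches-top i u₃≡i) (u₂-matches-bottom j u₂≡j)
    by-cases (inj₂ (i , u₃≡i)) (inj₁ u₂-spare) = top-and-spare (u₃-matches-top i u₃≡i) u₂-spare
    by-cases (inj₁ u₃-spare) (inj₁ u₂-spare) =
      proper u₃ u₂ (inj₂ u₂-u₃) (spares-agree u₃-spare u₂-spare)
    by-cases (inj₁ u₃-spare) (inj₂ (j , u₂≡j)) =
      StarColouring₂₊ₖ.top-and-spare (f ∘ mirror)
        (isStar-comap mirror mirror-injective edge-mirror f-star)
        (subst (λ i → f u₂ ≡ f (κ i)) (sym (Finₚ.opposite-involutive bottom))
               (u₂-matches-bottom j u₂≡j))
        (u₃-spare ∘ opposite)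

  toℕ≢-if-≥ : ∀ (i : Fin (suc k)) {t} → suc k ≤ t → toℕ i ≢ t
  toℕ≢-if-≥ i 1+k≤t = ℕₚ.<⇒≢ (ℕₚ.<-≤-trans (Finₚ.toℕ<n i) 1+k≤t)

  toℕ≢1+k : ∀ (i : Fin (suc k)) → toℕ i ≢ suc k
  toℕ≢1+k i = toℕ≢-if-≥ i ℕₚ.≤-refl

  toℕ≢2+k : ∀ (i : Fin (suc k)) → toℕ i ≢ 2 + k
  toℕ≢2+k i = toℕ≢-if-≥ i (ℕₚ.n≤1+n _)

  κ-cong-toℕ : ∀ {i j} → toℕ i ≡ toℕ j → _≡_ {A = V} (κ i) (κ j)
  κ-cong-toℕ = cong κ ∘ Finₚ.toℕ-injective

  E∖-sym : ∀ {p q u v} → (E ∖ (p , q)) u v → (E ∖ (p , q)) v u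
  E∖-sym = ∖-sym (undirected-sym {R = Arc})

  module Colouring₃₊ₖ where

    colour : V → ℕ
    colour (κ i) = toℕ i
    colour u₃    = 1 + k
    colour u₂    = 2 + k
    colour u₁    = 0
    colour u₀    = 0

    colour< : ∀ v → colour v < 3 + k
    colour< (κ i) = ℕₚ.m<n⇒m<1+n (ℕₚ.m<n⇒m<1+n (Finₚ.toℕ<n i))
    colour< u₃    = ℕₚ.m<n⇒m<1+n (ℕₚ.n<1+n _)
    colour< u₂    = ℕₚ.n<1+n _
    colour< u₁    = s≤s z≤n
    colour< u₀    = s≤s z≤n

    proper : ∀ {u v} → Arc u v → colour u ≢ colour v
    proper (κ-κ i≢j)   = i≢j ∘ Finₚ.toℕ-injective
    proper (u₃-κ {i} _) = toℕ≢1+k i ∘ sym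
    proper (u₂-κ {i} _) = toℕ≢2+k i ∘ sym
    proper u₂-u₃       = ℕₚ.1+n≢n
    proper u₁-u₃       = λ ()
    proper u₀-u₂       = λ ()

    repeats : ∀ u w → u ≢ w → colour u ≡ colour w → colour u ≡ 0
    repeats u₁    _     _   _  = refl
    repeats u₀    _     _   _  = refl
    repeats _     u₁    _   uw = uw
    repeats _     u₀    _   uw = uw
    repeats (κ i) (κ j) u≢w uw = ⊥-elim (u≢w (κ-cong-toℕ uw))
    repeats (κ i) u₃    _   uw = ⊥-elim (toℕ≢1+k i uw)
    repeats (κ i) u₂    _   uw = ⊥-elim (toℕ≢2+k i uw)
    repeats u₃    (κ j) _   uw = ⊥-elim (toℕ≢1+k j (sym uw))
    repeats u₃    u₃    u≢w _  = ⊥-elim (u≢w refl)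
    repeats u₃    u₂    _   uw = ⊥-elim (ℕₚ.1+n≢n (sym uw))
    repeats u₂    (κ j) _   uw = ⊥-elim (toℕ≢2+k j (sym uw))
    repeats u₂    u₃    _   uw = ⊥-elim (ℕₚ.1+n≢n uw)
    repeats u₂    u₂    u≢w _  = ⊥-elim (u≢w refl)

    starColouring : Σ (V → Fin (3 + k)) (IsStar E)
    starColouring = starColouring-fromℕ colour colour<
      (isStar-if-one-repeated-colour (isProper-undirected proper) 0 repeats)

  module Colouring-u₁u₃ where

    colour : V → ℕ
    colour (κ i) = toℕ i
    colour u₃    = k
    colour u₂    = 1 + k
    colour u₁    = k
    colour u₀    = k

    colour< : ∀ v → colour v < 2 + k
    colour< (κ i) = ℕₚ.m<n⇒m<1+n (Finₚ.toℕ<n i)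
    colour< u₃    = ℕₚ.m<n⇒m<1+n (ℕₚ.n<1+n _)
    colour< u₂    = ℕₚ.n<1+n _
    colour< u₁    = ℕₚ.m<n⇒m<1+n (ℕₚ.n<1+n _)
    colour< u₀    = ℕₚ.m<n⇒m<1+n (ℕₚ.n<1+n _)

    proper : ∀ {u v} → Arc u v → ¬ Pair u₁ u₃ u v → colour u ≢ colour v
    proper (κ-κ i≢j)   _     = i≢j ∘ Finₚ.toℕ-injective
    proper (u₃-κ i<k)  _     = ℕₚ.<⇒≢ i<k ∘ sym
    proper (u₂-κ {i} _) _    = toℕ≢1+k i ∘ sym
    proper u₂-u₃       _     = ℕₚ.1+n≢n
    proper u₁-u₃       ¬pair = ⊥-elim (¬pair (inj₁ (refl , refl)))
    proper u₀-u₂       _     = ℕₚ.1+n≢n ∘ sym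

    repeats : ∀ u w → u ≢ w → colour u ≡ colour w → colour u ≡ k
    repeats u₃    _     _   _  = refl
    repeats u₁    _     _   _  = refl
    repeats u₀    _     _   _  = refl
    repeats _     u₃    _   uw = uw
    repeats _     u₁    _   uw = uw
    repeats _     u₀    _   uw = uw
    repeats (κ i) (κ j) u≢w uw = ⊥-elim (u≢w (κ-cong-toℕ uw))
    repeats (κ i) u₂    _   uw = ⊥-elim (toℕ≢1+k i uw)
    repeats u₂    (κ j) _   uw = ⊥-elim (toℕ≢1+k j (sym uw))
    repeats u₂    u₂    u≢w _  = ⊥-elim (u≢w refl)

    starColouring : Σ (V → Fin (2 + k)) (IsStar (E ∖ (u₁ , u₃)))
    starColouring = starColouring-fromℕ colour colour<
      (isStar-if-one-repeated-colour (isProper-undirected-∖ proper) k repeats)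

  module Colouring-u₀u₂ where

    colour : V → ℕ
    colour (κ i) = toℕ i
    colour u₃    = 1 + k
    colour u₂    = 0
    colour u₁    = 0
    colour u₀    = 0

    colour< : ∀ v → colour v < 2 + k
    colour< (κ i) = ℕₚ.m<n⇒m<1+n (Finₚ.toℕ<n i)
    colour< u₃    = ℕₚ.n<1+n _
    colour< u₂    = s≤s z≤n
    colour< u₁    = s≤s z≤n
    colour< u₀    = s≤s z≤n

    proper : ∀ {u v} → Arc u v → ¬ Pair u₀ u₂ u v → colour u ≢ colour v
    proper (κ-κ i≢j)    _     = i≢j ∘ Finₚ.toℕ-injective
    proper (u₃-κ {i} _) _     = toℕ≢1+k i ∘ sym
    proper (u₂-κ 1≤i)   _     = ℕₚ.<⇒≢ 1≤i
    proper u₂-u₃        _     = λ ()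
    proper u₁-u₃        _     = λ ()
    proper u₀-u₂        ¬pair = ⊥-elim (¬pair (inj₁ (refl , refl)))

    repeats : ∀ u w → u ≢ w → colour u ≡ colour w → colour u ≡ 0
    repeats u₂    _     _   _  = refl
    repeats u₁    _     _   _  = refl
    repeats u₀    _     _   _  = refl
    repeats _     u₂    _   uw = uw
    repeats _     u₁    _   uw = uw
    repeats _     u₀    _   uw = uw
    repeats (κ i) (κ j) u≢w uw = ⊥-elim (u≢w (κ-cong-toℕ uw))
    repeats (κ i) u₃    _   uw = ⊥-elim (toℕ≢1+k i uw)
    repeats u₃    (κ j) _   uw = ⊥-elim (toℕ≢1+k j (sym uw))
    repeats u₃    u₃    u≢w _  = ⊥-elim (u≢w refl)

    starColouring : Σ (V → Fin (2 + k)) (IsStar (E ∖ (u₀ , u₂)))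
    starColouring = starColouring-fromℕ colour colour<
      (isStar-if-one-repeated-colour (isProper-undirected-∖ proper) 0 repeats)

  module Colouring-u₂u₃ where

    colour : V → ℕ
    colour (κ i) = toℕ i
    colour u₃    = 1 + k
    colour u₂    = 1 + k
    colour u₁    = 0
    colour u₀    = 0

    colour< : ∀ v → colour v < 2 + k
    colour< (κ i) = ℕₚ.m<n⇒m<1+n (Finₚ.toℕ<n i)
    colour< u₃    = ℕₚ.n<1+n _
    colour< u₂    = ℕₚ.n<1+n _
    colour< u₁    = s≤s z≤n
    colour< u₀    = s≤s z≤n

    proper : ∀ {u v} → Arc u v → ¬ Pair u₂ u₃ u v → colour u ≢ colour v
    proper (κ-κ i≢j)    _     = i≢j ∘ Finₚ.toℕ-injective
    proper (u₃-κ {i} _) _     = toℕ≢1+k i ∘ sym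
    proper (u₂-κ {i} _) _     = toℕ≢1+k i ∘ sym
    proper u₂-u₃        ¬pair = ⊥-elim (¬pair (inj₁ (refl , refl)))
    proper u₁-u₃        _     = λ ()
    proper u₀-u₂        _     = λ ()

    repeats : ∀ u w → u ≢ w → colour u ≡ colour w → colour u ≡ 0 ⊎ Pair u₂ u₃ u w
    repeats u₁    _     _   _  = inj₁ refl
    repeats u₀    _     _   _  = inj₁ refl
    repeats _     u₁    _   uw = inj₁ uw
    repeats _     u₀    _   uw = inj₁ uw
    repeats (κ i) (κ j) u≢w uw = ⊥-elim (u≢w (κ-cong-toℕ uw))
    repeats (κ i) u₃    _   uw = ⊥-elim (toℕ≢1+k i uw)
    repeats (κ i) u₂    _   uw = ⊥-elim (toℕ≢1+k i uw)
    repeats u₃    (κ j) _   uw = ⊥-elim (toℕ≢1+k j (sym uw))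
    repeats u₃    u₃    u≢w _  = ⊥-elim (u≢w refl)
    repeats u₃    u₂    _   _  = inj₂ (inj₂ (refl , refl))
    repeats u₂    (κ j) _   uw = ⊥-elim (toℕ≢1+k j (sym uw))
    repeats u₂    u₃    _   _  = inj₂ (inj₁ (refl , refl))
    repeats u₂    u₂    u≢w _  = ⊥-elim (u≢w refl)

    no-common-neighbour : ∀ v → colour v ≡ 0 → (E ∖ (u₂ , u₃)) v u₂ → (E ∖ (u₂ , u₃)) v u₃ → ⊥
    no-common-neighbour (κ i) i≡0 (inj₂ (u₂-κ 1≤i) , _) _ = ℕₚ.<⇒≢ 1≤i (sym i≡0)
    no-common-neighbour u₁    _   (inj₁ () , _)         _
    no-common-neighbour u₁    _   (inj₂ () , _)         _
    no-common-neighbour u₀    _   _                     (inj₁ () , _)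
    no-common-neighbour u₀    _   _                     (inj₂ () , _)

    starColouring : Σ (V → Fin (2 + k)) (IsStar (E ∖ (u₂ , u₃)))
    starColouring = starColouring-fromℕ colour colour<
      (isStar-if-one-repeated-colour-and-pair (isProper-undirected-∖ proper) 0 u₂ u₃ E∖-sym
        repeats no-common-neighbour)

  module Colouring-u₃κ (i₀ : Fin (suc k)) (i₀<k : toℕ i₀ < k) where

    colour : V → ℕ
    colour (κ i) = toℕ i
    colour u₃    = toℕ i₀
    colour u₂    = 1 + k
    colour u₁    = k
    colour u₀    = k

    colour< : ∀ v → colour v < 2 + k
    colour< (κ i) = ℕₚ.m<n⇒m<1+n (Finₚ.toℕ<n i)
    colour< u₃    = ℕₚ.m<n⇒m<1+n (Finₚ.toℕ<n i₀)
    colour< u₂    = ℕₚ.n<1+n _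
    colour< u₁    = ℕₚ.m<n⇒m<1+n (ℕₚ.n<1+n _)
    colour< u₀    = ℕₚ.m<n⇒m<1+n (ℕₚ.n<1+n _)

    proper : ∀ {u v} → Arc u v → ¬ Pair u₃ (κ i₀) u v → colour u ≢ colour v
    proper (κ-κ i≢j)    _     = i≢j ∘ Finₚ.toℕ-injective
    proper (u₃-κ _)     ¬pair = λ i₀≡i → ¬pair (inj₁ (refl , κ-cong-toℕ (sym i₀≡i)))
    proper (u₂-κ {i} _) _     = toℕ≢1+k i ∘ sym
    proper u₂-u₃        _     = toℕ≢1+k i₀ ∘ sym
    proper u₁-u₃        _     = ℕₚ.<⇒≢ i₀<k ∘ sym
    proper u₀-u₂        _     = ℕₚ.1+n≢n ∘ sym

    repeats : ∀ u w → u ≢ w → colour u ≡ colour w → colour u ≡ k ⊎ Pair u₃ (κ i₀) u w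
    repeats u₁    _     _   _  = inj₁ refl
    repeats u₀    _     _   _  = inj₁ refl
    repeats _     u₁    _   uw = inj₁ uw
    repeats _     u₀    _   uw = inj₁ uw
    repeats (κ i) (κ j) u≢w uw = ⊥-elim (u≢w (κ-cong-toℕ uw))
    repeats (κ i) u₃    _   uw = inj₂ (inj₂ (κ-cong-toℕ uw , refl))
    repeats (κ i) u₂    _   uw = ⊥-elim (toℕ≢1+k i uw)
    repeats u₃    (κ j) _   uw = inj₂ (inj₁ (refl , κ-cong-toℕ (sym uw)))
    repeats u₃    u₃    u≢w _  = ⊥-elim (u≢w refl)
    repeats u₃    u₂    _   uw = ⊥-elim (toℕ≢1+k i₀ uw)
    repeats u₂    (κ j) _   uw = ⊥-elim (toℕ≢1+k j (sym uw))
    repeats u₂    u₃    _   uw = ⊥-elim (toℕ≢1+k i₀ (sym uw))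
    repeats u₂    u₂    u≢w _  = ⊥-elim (u≢w refl)

    no-common-neighbour : ∀ v → colour v ≡ k → (E ∖ (u₃ , κ i₀)) v u₃ →
                          (E ∖ (u₃ , κ i₀)) v (κ i₀) → ⊥
    no-common-neighbour (κ i) i≡k (inj₂ (u₃-κ i<k) , _) _ = ℕₚ.<⇒≢ i<k i≡k
    no-common-neighbour u₃    i₀≡k _                    _ = ℕₚ.<⇒≢ i₀<k i₀≡k
    no-common-neighbour u₂    1+k≡k _                   _ = ℕₚ.1+n≢n 1+k≡k
    no-common-neighbour u₁    _   _                     (inj₁ () , _)
    no-common-neighbour u₁    _   _                     (inj₂ () , _)
    no-common-neighbour u₀    _   (inj₁ () , _)         _
    no-common-neighbour u₀    _   (inj₂ () , _)         _

    starColouring : Σ (V → Fin (2 + k)) (IsStar (E ∖ (u₃ , κ i₀)))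
    starColouring = starColouring-fromℕ colour colour<
      (isStar-if-one-repeated-colour-and-pair (isProper-undirected-∖ proper) k u₃ (κ i₀) E∖-sym
        repeats no-common-neighbour)

  module Colouring-u₂κ (i₀ : Fin (suc k)) (1≤i₀ : 1 ≤ toℕ i₀) where

    colour : V → ℕ
    colour (κ i) = toℕ i
    colour u₃    = 1 + k
    colour u₂    = toℕ i₀
    colour u₁    = 0
    colour u₀    = 0

    colour< : ∀ v → colour v < 2 + k
    colour< (κ i) = ℕₚ.m<n⇒m<1+n (Finₚ.toℕ<n i)
    colour< u₃    = ℕₚ.n<1+n _
    colour< u₂    = ℕₚ.m<n⇒m<1+n (Finₚ.toℕ<n i₀)
    colour< u₁    = s≤s z≤n
    colour< u₀    = s≤s z≤n

    proper : ∀ {u v} → Arc u v → ¬ Pair u₂ (κ i₀) u v → colour u ≢ colour v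
    proper (κ-κ i≢j)    _     = i≢j ∘ Finₚ.toℕ-injective
    proper (u₃-κ {i} _) _     = toℕ≢1+k i ∘ sym
    proper (u₂-κ _)     ¬pair = λ i₀≡i → ¬pair (inj₁ (refl , κ-cong-toℕ (sym i₀≡i)))
    proper u₂-u₃        _     = toℕ≢1+k i₀
    proper u₁-u₃        _     = λ ()
    proper u₀-u₂        _     = ℕₚ.<⇒≢ 1≤i₀

    repeats : ∀ u w → u ≢ w → colour u ≡ colour w → colour u ≡ 0 ⊎ Pair u₂ (κ i₀) u w
    repeats u₁    _     _   _  = inj₁ refl
    repeats u₀    _     _   _  = inj₁ refl
    repeats _     u₁    _   uw = inj₁ uw
    repeats _     u₀    _   uw = inj₁ uw
    repeats (κ i) (κ j) u≢w uw = ⊥-elim (u≢w (κ-cong-toℕ uw))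
    repeats (κ i) u₃    _   uw = ⊥-elim (toℕ≢1+k i uw)
    repeats (κ i) u₂    _   uw = inj₂ (inj₂ (κ-cong-toℕ uw , refl))
    repeats u₃    (κ j) _   uw = ⊥-elim (toℕ≢1+k j (sym uw))
    repeats u₃    u₃    u≢w _  = ⊥-elim (u≢w refl)
    repeats u₃    u₂    _   uw = ⊥-elim (toℕ≢1+k i₀ (sym uw))
    repeats u₂    (κ j) _   uw = inj₂ (inj₁ (refl , κ-cong-toℕ (sym uw)))
    repeats u₂    u₃    _   uw = ⊥-elim (toℕ≢1+k i₀ uw)
    repeats u₂    u₂    u≢w _  = ⊥-elim (u≢w refl)

    no-common-neighbour : ∀ v → colour v ≡ 0 → (E ∖ (u₂ , κ i₀)) v u₂ →
                          (E ∖ (u₂ , κ i₀)) v (κ i₀) → ⊥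
    no-common-neighbour (κ i) i≡0 (inj₂ (u₂-κ 1≤i) , _) _ = ℕₚ.<⇒≢ 1≤i (sym i≡0)
    no-common-neighbour u₂    i₀≡0 _                    _ = ℕₚ.<⇒≢ 1≤i₀ (sym i₀≡0)
    no-common-neighbour u₁    _   (inj₁ () , _)         _
    no-common-neighbour u₁    _   (inj₂ () , _)         _
    no-common-neighbour u₀    _   _                     (inj₁ () , _)
    no-common-neighbour u₀    _   _                     (inj₂ () , _)

    starColouring : Σ (V → Fin (2 + k)) (IsStar (E ∖ (u₂ , κ i₀)))
    starColouring = starColouring-fromℕ colour colour<
      (isStar-if-one-repeated-colour-and-pair (isProper-undirected-∖ proper) 0 u₂ (κ i₀) E∖-sym
        repeats no-common-neighbour)

  module Colouring-κκ (i₀ j₀ : Fin (suc k)) (i₀≢j₀ : i₀ ≢ j₀) where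

    κ-colour : Fin (suc k) → ℕ
    κ-colour i with i Finₚ.≟ j₀
    ... | yes _ = toℕ i₀
    ... | no _  = toℕ i

    κ-colour-cases : ∀ i → (i ≡ j₀ × κ-colour i ≡ toℕ i₀) ⊎ (i ≢ j₀ × κ-colour i ≡ toℕ i)
    κ-colour-cases i with i Finₚ.≟ j₀
    ... | yes i≡j₀ = inj₁ (i≡j₀ , refl)
    ... | no i≢j₀  = inj₂ (i≢j₀ , refl)

    κ-colour< : ∀ i → κ-colour i < suc k
    κ-colour< i with κ-colour-cases i
    ... | inj₁ (_ , ci≡i₀) = subst (_< suc k) (sym ci≡i₀) (Finₚ.toℕ<n i₀)
    ... | inj₂ (_ , ci≡i)  = subst (_< suc k) (sym ci≡i) (Finₚ.toℕ<n i)

    colour : V → ℕ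
    colour (κ i) = κ-colour i
    colour u₃    = toℕ j₀
    colour u₂    = 1 + k
    colour u₁    = toℕ i₀
    colour u₀    = toℕ i₀

    colour< : ∀ v → colour v < 2 + k
    colour< (κ i) = ℕₚ.m<n⇒m<1+n (κ-colour< i)
    colour< u₃    = ℕₚ.m<n⇒m<1+n (Finₚ.toℕ<n j₀)
    colour< u₂    = ℕₚ.n<1+n _
    colour< u₁    = ℕₚ.m<n⇒m<1+n (Finₚ.toℕ<n i₀)
    colour< u₀    = ℕₚ.m<n⇒m<1+n (Finₚ.toℕ<n i₀)

    toℕ-i₀≢j₀ : toℕ i₀ ≢ toℕ j₀
    toℕ-i₀≢j₀ = i₀≢j₀ ∘ Finₚ.toℕ-injective

    proper : ∀ {u v} → Arc u v → ¬ Pair (κ i₀) (κ j₀) u v → colour u ≢ colour v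
    proper (κ-κ {i} {j} i≢j) ¬pair ci≡cj with κ-colour-cases i | κ-colour-cases j
    ... | inj₁ (refl , _)   | inj₁ (refl , _)   = i≢j refl
    ... | inj₁ (refl , ci)  | inj₂ (_ , cj)     =
      ¬pair (inj₂ (refl , κ-cong-toℕ (trans (sym cj) (trans (sym ci≡cj) ci))))
    ... | inj₂ (_ , ci)     | inj₁ (refl , cj)  =
      ¬pair (inj₁ (κ-cong-toℕ (trans (sym ci) (trans ci≡cj cj)) , refl))
    ... | inj₂ (_ , ci)     | inj₂ (_ , cj)     =
      i≢j (Finₚ.toℕ-injective (trans (sym ci) (trans ci≡cj cj)))
    proper (u₃-κ {i} _) _ j₀≡ci with κ-colour-cases i
    ... | inj₁ (_ , ci)     = toℕ-i₀≢j₀ (sym (trans j₀≡ci ci))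
    ... | inj₂ (i≢j₀ , ci)  = i≢j₀ (Finₚ.toℕ-injective (sym (trans j₀≡ci ci)))
    proper (u₂-κ {i} _) _ = ℕₚ.<⇒≢ (κ-colour< i) ∘ sym
    proper u₂-u₃        _ = toℕ≢1+k j₀ ∘ sym
    proper u₁-u₃        _ = toℕ-i₀≢j₀
    proper u₀-u₂        _ = toℕ≢1+k i₀

    repeats : ∀ u w → u ≢ w → colour u ≡ colour w → colour u ≡ toℕ i₀
    repeats u₁    _     _   _  = refl
    repeats u₀    _     _   _  = refl
    repeats _     u₁    _   uw = uw
    repeats _     u₀    _   uw = uw
    repeats (κ i) (κ j) u≢w uw with κ-colour-cases i | κ-colour-cases j
    ... | inj₁ (_ , ci) | _             = ci
    ... | inj₂ _        | inj₁ (_ , cj) = trans uw cj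
    ... | inj₂ (_ , ci) | inj₂ (_ , cj) = ⊥-elim (u≢w (κ-cong-toℕ (trans (sym ci) (trans uw cj))))
    repeats (κ i) u₃    _   uw with κ-colour-cases i
    ... | inj₁ (_ , ci)    = ci
    ... | inj₂ (i≢j₀ , ci) = ⊥-elim (i≢j₀ (Finₚ.toℕ-injective (trans (sym ci) uw)))
    repeats (κ i) u₂    _   uw = ⊥-elim (ℕₚ.<⇒≢ (κ-colour< i) uw)
    repeats u₃    (κ j) _   uw with κ-colour-cases j
    ... | inj₁ (_ , cj)    = trans uw cj
    ... | inj₂ (j≢j₀ , cj) = ⊥-elim (j≢j₀ (Finₚ.toℕ-injective (sym (trans uw cj))))
    repeats u₃    u₃    u≢w _  = ⊥-elim (u≢w refl)
    repeats u₃    u₂    _   uw = ⊥-elim (toℕ≢1+k j₀ uw)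
    repeats u₂    (κ j) _   uw = ⊥-elim (ℕₚ.<⇒≢ (κ-colour< j) (sym uw))
    repeats u₂    u₃    _   uw = ⊥-elim (toℕ≢1+k j₀ (sym uw))
    repeats u₂    u₂    u≢w _  = ⊥-elim (u≢w refl)

    starColouring : Σ (V → Fin (2 + k)) (IsStar (E ∖ (κ i₀ , κ j₀)))
    starColouring = starColouring-fromℕ colour colour<
      (isStar-if-one-repeated-colour (isProper-undirected-∖ proper) (toℕ i₀) repeats)

  arc-deletion-colouring : ∀ {p q} → Arc p q → Σ (V → Fin (2 + k)) (IsStar (E ∖ (p , q)))
  arc-deletion-colouring (κ-κ i≢j)  = Colouring-κκ.starColouring _ _ i≢j
  arc-deletion-colouring (u₃-κ i<k) = Colouring-u₃κ.starColouring _ i<k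
  arc-deletion-colouring (u₂-κ 1≤i) = Colouring-u₂κ.starColouring _ 1≤i
  arc-deletion-colouring u₂-u₃      = Colouring-u₂u₃.starColouring
  arc-deletion-colouring u₁-u₃      = Colouring-u₁u₃.starColouring
  arc-deletion-colouring u₀-u₂      = Colouring-u₀u₂.starColouring

  deletion-colourable-via-view :
    ∀ {c p q x y} → Σ (V → Fin c) (IsStar (E ∖ (p , q))) →
    (∀ {u v} → (E ∖ (view x , view y)) u v → (E ∖ (p , q)) u v) →
    StarColourable (D n ─ (x , y)) c
  deletion-colourable-via-view (col , star) ⊆ = col ∘ view , isStar⇒starColouring
    (isStar-comap view view-injective
      (⊆ ∘ ∖-hom {H = D n} {G = E} view view-injective edge-view) star)

  deletion-colourable : ∀ {x y} → D n x y → StarColourable (D n ─ (x , y)) (2 + k)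
  deletion-colourable xy with edge-view xy
  ... | inj₁ arc = deletion-colourable-via-view (arc-deletion-colouring arc) id
  ... | inj₂ arc = deletion-colourable-via-view (arc-deletion-colouring arc) (∖-swap {G = E})

  critical : Critical (D n) (3 + k)
  critical = (colourable , too-few) , λ x y xy →
    let m , m≤2+k , χ = starChromatic-≤ (starColourable? (D-deletion? n (x , y))) (2 + k)
                                         (deletion-colourable xy)
    in m , s≤s m≤2+k , χ
    where
    colourable : StarColourable (D n) (3 + k)
    colourable = let col , star = Colouring₃₊ₖ.starColouring in
      col ∘ view , isStar⇒starColouring (isStar-comap {H = D n} view view-injective edge-view star)

    too-few : ∀ m → m < 3 + k → ¬ StarColourable (D n) m
    too-few m m<3+k colourableₘ =
      let col , star = starColourable-mono (ℕₚ.≤-pred m<3+k) colourableₘ in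
      no-star-colouring₂₊ₖ (col ∘ emb)
        (isStar-comap emb emb-injective edge-emb (starColouring⇒isStar star))

mainTheorem16 : (n : ℕ) → 5 ≤ n → Critical (D n) (n ∸ 2)
mainTheorem16 _ (s≤s (s≤s (s≤s (s≤s (s≤s {n = k} z≤n))))) = Dₙ.critical k
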